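{- Let $(S,\preceq,\otimes_1,\otimes_2,D_1,D_2,\{e\},\{e\})$ be a positive, serially-decomposable partial interchange monoid and $(Q,\le,\bullet,\diamond,1)$ an interchange quantale. On $Q^S$ define $(f\ast g)(x)=\bigvee\{f(y)\bullet g(z)\mid D_1\,y\,z,\ x=y\otimes_1 z\}$, $(f\circledast g)(x)=\bigvee\{f(y)\diamond g(z)\mid D_2\,y\,z,\ x\preceq y\otimes_2 z\}$ and $\mathit{id}(e)=1$, $\mathit{id}(x)=0$ for $x\neq e$. Let $A\subseteq Q^S$ be the set of antitone functions ($x\preceq y\Rightarrow f(y)\le f(x)$). Then $A$ contains $\mathit{id}$ and is closed under pointwise arbitrary sups, $\ast$ and $\circledast$, and $(A,\le,\ast,\circledast,\mathit{id})$ (pointwise order) is a unital interchange quantale with unit $\mathit{id}$.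
   Context: A partial monoid $(S,\otimes,D,E)$: $D\subseteq S\times S$, $\otimes:D\to S$, with $(D\,x\,y\wedge D\,(x\otimes y)\,z)\Leftrightarrow(D\,y\,z\wedge D\,x\,(y\otimes z))$ and then $x\otimes(y\otimes z)=(x\otimes y)\otimes z$; $E\subseteq S$ such that each $x$ has $e\in E$ with $D\,e\,x$, $e\otimes x=x$, and $e'\in E$ with $D\,x\,e'$, $x\otimes e'=x$, and $D\,e_1\,e_2\Rightarrow e_1=e_2$ for $e_1,e_2\in E$. Preordered by preorder $\preceq$: $x\preceq y\wedge D\,z\,x\Rightarrow D\,z\,y\wedge z\otimes x\preceq z\otimes y$ and $x\preceq y\wedge D\,x\,z\Rightarrow D\,y\,z\wedge x\otimes z\preceq y\otimes z$. A partial interchange monoid $(S,\preceq,\otimes_1,\otimes_2,D_1,D_2,E_1,E_2)$: $(S,\preceq,\otimes_i,D_i,E_i)$ preordered partial monoids, $E_2\subseteq E_1$, and for all $w,x,y,z$: if $D_2\,w\,x$, $D_1\,(w\otimes_2 x)\,(y\otimes_2 z)$, $D_2\,y\,z$ then $D_1\,w\,y$, $D_2\,(w\otimes_1 y)\,(x\otimes_1 z)$, $D_1\,x\,z$ and $(w\otimes_2x)\otimes_1(y\otimes_2z)\preceq(w\otimes_1y)\otimes_2(x\otimes_1z)$. With single unit $e$, it is positive if $e$ is a minimal element of $S$ with respect to $\preceq$, and serially-decomposable if $x\preceq y_1\otimes_1 y_2$ (with $D_1\,y_1\,y_2$) implies there exist $x_1,x_2$ with $D_1\,x_1\,x_2$,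 $x=x_1\otimes_1x_2$, $x_1\preceq y_1$ and $x_2\preceq y_2$. An interchange quantale $(Q,\le,\bullet,\diamond,1)$: complete lattice with two associative binary operations each preserving arbitrary sups in both arguments, common two-sided unit $1$, and $(a\diamond b)\bullet(c\diamond d)\le(a\bullet c)\diamond(b\bullet d)$. -}

module Defs where

open import Data.Product using (Σ; Σ-syntax; _×_; _,_; proj₁; proj₂)
open import Data.Empty using (⊥)
open import Relation.Binary.PropositionalEquality using (_≡_)
open import Relation.Binary.Structures using (IsPreorder; IsPartialOrder)

-- Partial monoids. The partial operation is modelled as a total
-- function _⊗_ together with its domain of definition D; values of
-- x ⊗ y outside D are never used.

record IsPreorderedPartialMonoid {S : Set} (_≼_ : S → S → Set)
         (D : S → S → Set) (_⊗_ : S → S → S) (E : S → Set) : Set where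
  field
    ≼-isPreorder : IsPreorder _≡_ _≼_
    D-assoc→     : ∀ x y z → D x y × D (x ⊗ y) z → D y z × D x (y ⊗ z)
    D-assoc←     : ∀ x y z → D y z × D x (y ⊗ z) → D x y × D (x ⊗ y) z
    assoc        : ∀ x y z → D x y → D (x ⊗ y) z → x ⊗ (y ⊗ z) ≡ (x ⊗ y) ⊗ z
    left-unit    : ∀ x → Σ[ e ∈ S ] (E e × D e x × e ⊗ x ≡ x)
    right-unit   : ∀ x → Σ[ e ∈ S ] (E e × D x e × x ⊗ e ≡ x)
    unit-unique  : ∀ e₁ e₂ → E e₁ → E e₂ → D e₁ e₂ → e₁ ≡ e₂
    mono-right   : ∀ x y z → x ≼ y → D z x → D z y × (z ⊗ x) ≼ (z ⊗ y)
    mono-left    : ∀ x y z → x ≼ y → D x z → D y z × (x ⊗ z) ≼ (y ⊗ z)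

record IsPartialInterchangeMonoid {S : Set} (_≼_ : S → S → Set)
         (D₁ D₂ : S → S → Set) (_⊗₁_ _⊗₂_ : S → S → S) (E₁ E₂ : S → Set) : Set where
  field
    isPM₁       : IsPreorderedPartialMonoid _≼_ D₁ _⊗₁_ E₁
    isPM₂       : IsPreorderedPartialMonoid _≼_ D₂ _⊗₂_ E₂
    E₂⊆E₁       : ∀ x → E₂ x → E₁ x
    interchange : ∀ w x y z → D₂ w x → D₁ (w ⊗₂ x) (y ⊗₂ z) → D₂ y z →
                  D₁ w y × D₂ (w ⊗₁ y) (x ⊗₁ z) × D₁ x z ×
                  ((w ⊗₂ x) ⊗₁ (y ⊗₂ z)) ≼ ((w ⊗₁ y) ⊗₂ (x ⊗₁ z))

record SingleUnitPIM : Set₁ where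
  field
    S     : Set
    _≼_   : S → S → Set
    D₁ D₂ : S → S → Set
    _⊗₁_ _⊗₂_ : S → S → S
    e     : S
    isPIM : IsPartialInterchangeMonoid _≼_ D₁ D₂ _⊗₁_ _⊗₂_ (_≡ e) (_≡ e)

module _ (M : SingleUnitPIM) where
  open SingleUnitPIM M

  Positive : Set
  Positive = ∀ x → x ≼ e → x ≡ e

  SeriallyDecomposable : Set
  SeriallyDecomposable = ∀ x y₁ y₂ → D₁ y₁ y₂ → x ≼ (y₁ ⊗₁ y₂) →
    Σ[ x₁ ∈ S ] Σ[ x₂ ∈ S ]
      (D₁ x₁ x₂ × x ≡ x₁ ⊗₁ x₂ × x₁ ≼ y₁ × x₂ ≼ y₂)

record IsInterchangeQuantale (C : Set) (_≈_ _≤_ : C → C → Set)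
         (⋁ : ∀ {I : Set} → (I → C) → C) (_•_ _◇_ : C → C → C) (𝟙 : C) : Set₁ where
  field
    isPartialOrder : IsPartialOrder _≈_ _≤_
    ⋁-upper  : ∀ {I : Set} (f : I → C) (i : I) → f i ≤ ⋁ f
    ⋁-least  : ∀ {I : Set} (f : I → C) (c : C) → (∀ i → f i ≤ c) → ⋁ f ≤ c
    •-assoc  : ∀ a b c → ((a • b) • c) ≈ (a • (b • c))
    ◇-assoc  : ∀ a b c → ((a ◇ b) ◇ c) ≈ (a ◇ (b ◇ c))
    •-⋁ˡ     : ∀ {I : Set} (f : I → C) b → ((⋁ f) • b) ≈ ⋁ (λ i → f i • b)
    •-⋁ʳ     : ∀ {I : Set} a (f : I → C) → (a • ⋁ f) ≈ ⋁ (λ i → a • f i)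
    ◇-⋁ˡ     : ∀ {I : Set} (f : I → C) b → ((⋁ f) ◇ b) ≈ ⋁ (λ i → f i ◇ b)
    ◇-⋁ʳ     : ∀ {I : Set} a (f : I → C) → (a ◇ ⋁ f) ≈ ⋁ (λ i → a ◇ f i)
    •-identityˡ : ∀ a → (𝟙 • a) ≈ a
    •-identityʳ : ∀ a → (a • 𝟙) ≈ a
    ◇-identityˡ : ∀ a → (𝟙 ◇ a) ≈ a
    ◇-identityʳ : ∀ a → (a ◇ 𝟙) ≈ a
    interchange : ∀ a b c d → ((a ◇ b) • (c ◇ d)) ≤ ((a • c) ◇ (b • d))

record InterchangeQuantale : Set₁ where
  field
    Carrier : Set
    _≤_     : Carrier → Carrier → Set
    ⋁       : ∀ {I : Set} → (I → Carrier) → Carrier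
    _•_ _◇_ : Carrier → Carrier → Carrier
    𝟙       : Carrier
    isInterchangeQuantale : IsInterchangeQuantale Carrier _≡_ _≤_ ⋁ _•_ _◇_ 𝟙

module Convolution (M : SingleUnitPIM) (Q : InterchangeQuantale) where
  open SingleUnitPIM M
  open InterchangeQuantale Q

  𝟘 : Carrier
  𝟘 = ⋁ {I = ⊥} (λ ())

  _∗_ : (S → Carrier) → (S → Carrier) → S → Carrier
  (f ∗ g) x = ⋁ {I = Σ[ y ∈ S ] Σ[ z ∈ S ] (D₁ y z × x ≡ y ⊗₁ z)}
                (λ p → f (proj₁ p) • g (proj₁ (proj₂ p)))

  _⊛_ : (S → Carrier) → (S → Carrier) → S → Carrier
  (f ⊛ g) x = ⋁ {I = Σ[ y ∈ S ] Σ[ z ∈ S ] (D₂ y z × x ≼ (y ⊗₂ z))}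
                (λ p → f (proj₁ p) ◇ g (proj₁ (proj₂ p)))

  -- id(x) = ⋁ { 1 | x = e }, i.e. id(e) = 1 and id(x) = 0 for x ≠ e.
  idf : S → Carrier
  idf x = ⋁ {I = x ≡ e} (λ _ → 𝟙)

  ⋁ₚ : ∀ {I : Set} → (I → S → Carrier) → S → Carrier
  ⋁ₚ F x = ⋁ (λ i → F i x)

  Antitone : (S → Carrier) → Set
  Antitone f = ∀ x y → x ≼ y → f y ≤ f x

  A : Set
  A = Σ (S → Carrier) Antitone

  _≈ᴬ_ : A → A → Set
  F ≈ᴬ G = ∀ x → proj₁ F x ≡ proj₁ G x

  _≤ᴬ_ : A → A → Set
  F ≤ᴬ G = ∀ x → proj₁ F x ≤ proj₁ G x

  SupClosed : Set₁
  SupClosed = ∀ {I : Set} (F : I → S → Carrier) → (∀ i → Antitone (F i)) → Antitone (⋁ₚ F)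

  ∗Closed : Set
  ∗Closed = ∀ f g → Antitone f → Antitone g → Antitone (f ∗ g)

  ⊛Closed : Set
  ⊛Closed = ∀ f g → Antitone f → Antitone g → Antitone (f ⊛ g)

  ⋁ᴬ : SupClosed → ∀ {I : Set} → (I → A) → A
  ⋁ᴬ cl F = ⋁ₚ (λ i → proj₁ (F i)) , cl (λ i → proj₁ (F i)) (λ i → proj₂ (F i))

  ∗ᴬ : ∗Closed → A → A → A
  ∗ᴬ cl F G = (proj₁ F ∗ proj₁ G) , cl (proj₁ F) (proj₁ G) (proj₂ F) (proj₂ G)

  ⊛ᴬ : ⊛Closed → A → A → A
  ⊛ᴬ cl F G = (proj₁ F ⊛ proj₁ G) , cl (proj₁ F) (proj₁ G) (proj₂ F) (proj₂ G)

module Submission where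

-- Both convolutions are instances of a single construction: for a
-- preordered partial monoid (S, ≼, D, ⊗, E) and a sup-preserving
-- associative operation · on Q with unit 1, put
--     (f ⋆ g)(x) = ⋁ { f y · g z | D y z, x ≼ y ⊗ z },   unit(x) = ⋁ { 1 | E x }.
-- The concurrent convolution ⊛ is this construction for (≼, ⊗₂, ◇); the
-- sequential convolution ∗ is it for (≡, ⊗₁, •), i.e. for the first monoid
-- with its preorder replaced by equality (lemma discrete).

open import Defs
open import Data.Bool using (Bool; true; false)
open import Data.Product using (Σ; Σ-syntax; _×_; _,_; proj₁; proj₂)
open import Relation.Binary.Bundles using (Poset)
open import Relation.Binary.PropositionalEquality
  using (_≡_; refl; sym; trans; cong; subst)
open import Relation.Binary.PropositionalEquality.Properties as ≡ using ()
open import Relation.Binary.Structures using (IsPreorder; IsPartialOrder)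

discrete : ∀ {S : Set} {_≼_ D : S → S → Set} {_⊗_ : S → S → S} {E : S → Set} →
  IsPreorderedPartialMonoid _≼_ D _⊗_ E → IsPreorderedPartialMonoid _≡_ D _⊗_ E
discrete pm = record
  { ≼-isPreorder = ≡.isPreorder
  ; D-assoc→     = D-assoc→
  ; D-assoc←     = D-assoc←
  ; assoc        = assoc
  ; left-unit    = left-unit
  ; right-unit   = right-unit
  ; unit-unique  = unit-unique
  ; mono-right   = λ { x .x z refl Dzx → Dzx , refl }
  ; mono-left    = λ { x .x z refl Dxz → Dxz , refl }
  }
  where open IsPreorderedPartialMonoid pm

module LatticeFacts (Q : InterchangeQuantale) where
  open InterchangeQuantale Q public
  open IsInterchangeQuantale isInterchangeQuantale public
  module PO = IsPartialOrder isPartialOrder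

  poset : Poset _ _ _
  poset = record { isPartialOrder = isPartialOrder }

  open import Relation.Binary.Reasoning.PartialOrder poset public

  ≤-refl : ∀ {a} → a ≤ a
  ≤-refl = PO.reflexive refl

  ≤-trans : ∀ {a b c} → a ≤ b → b ≤ c → a ≤ c
  ≤-trans = PO.trans

  ≡⇒≤ : ∀ {a b} → a ≡ b → a ≤ b
  ≡⇒≤ = PO.reflexive

  ≤-antisym : ∀ {a b} → a ≤ b → b ≤ a → a ≡ b
  ≤-antisym = PO.antisym

  ⋁≤ : ∀ {I : Set} {f : I → Carrier} {c} → (∀ i → f i ≤ c) → ⋁ f ≤ c
  ⋁≤ {f = f} {c} = ⋁-least f c

  -- Sups of pointwise equal families agree (there is no function
  -- extensionality, so this needs proof).
  ⋁-cong : ∀ {I : Set} {f g : I → Carrier} → (∀ i → f i ≡ g i) → ⋁ f ≡ ⋁ g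
  ⋁-cong {f = f} {g} f≡g = ≤-antisym
    (⋁≤ λ i → ≤-trans (≡⇒≤ (f≡g i)) (⋁-upper g i))
    (⋁≤ λ i → ≤-trans (≡⇒≤ (sym (f≡g i))) (⋁-upper f i))

  ⋁-comm : ∀ {I J : Set} (G : I → J → Carrier) →
    ⋁ (λ j → ⋁ (λ i → G i j)) ≡ ⋁ (λ i → ⋁ (λ j → G i j))
  ⋁-comm G = ≤-antisym
    (⋁≤ λ j → ⋁≤ λ i → ≤-trans (⋁-upper (G i) j) (⋁-upper (λ i → ⋁ (G i)) i))
    (⋁≤ λ i → ⋁≤ λ j → ≤-trans (⋁-upper (λ i → G i j) i)
                                (⋁-upper (λ j → ⋁ (λ i → G i j)) j))

  module SupPreserving (_·_ : Carrier → Carrier → Carrier)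
    (·-⋁ˡ : ∀ {I : Set} (f : I → Carrier) b → (⋁ f · b) ≡ ⋁ (λ i → f i · b))
    (·-⋁ʳ : ∀ {I : Set} a (f : I → Carrier) → (a · ⋁ f) ≡ ⋁ (λ i → a · f i)) where

    private
      pair : Carrier → Carrier → Bool → Carrier
      pair a b true  = a
      pair a b false = b

      ⋁-pair : ∀ {a b} → a ≤ b → ⋁ (pair a b) ≡ b
      ⋁-pair {a} {b} a≤b = ≤-antisym
        (⋁≤ λ { true → a≤b ; false → ≤-refl }) (⋁-upper (pair a b) false)

    -- Preservation of binary joins implies monotonicity.
    monoˡ : ∀ {a b c} → a ≤ b → (a · c) ≤ (b · c)
    monoˡ {a} {b} {c} a≤b = begin
      a · c                        ≤⟨ ⋁-upper (λ i → pair a b i · c) true ⟩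
      ⋁ (λ i → pair a b i · c)     ≡⟨ ·-⋁ˡ (pair a b) c ⟨
      ⋁ (pair a b) · c             ≡⟨ cong (_· c) (⋁-pair a≤b) ⟩
      b · c                        ∎

    monoʳ : ∀ {a b c} → a ≤ b → (c · a) ≤ (c · b)
    monoʳ {a} {b} {c} a≤b = begin
      c · a                        ≤⟨ ⋁-upper (λ i → c · pair a b i) true ⟩
      ⋁ (λ i → c · pair a b i)     ≡⟨ ·-⋁ʳ c (pair a b) ⟨
      c · ⋁ (pair a b)             ≡⟨ cong (c ·_) (⋁-pair a≤b) ⟩
      c · b                        ∎

    mono : ∀ {a b c d} → a ≤ b → c ≤ d → (a · c) ≤ (b · d)
    mono a≤b c≤d = ≤-trans (monoˡ a≤b) (monoʳ c≤d)

    ⋁·-least : ∀ {I : Set} {f : I → Carrier} {b c} →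
      (∀ i → (f i · b) ≤ c) → (⋁ f · b) ≤ c
    ⋁·-least {f = f} {b} h = ≤-trans (≡⇒≤ (·-⋁ˡ f b)) (⋁≤ h)

    ·⋁-least : ∀ {I : Set} {a c} {f : I → Carrier} →
      (∀ i → (a · f i) ≤ c) → (a · ⋁ f) ≤ c
    ·⋁-least {a = a} {f = f} h = ≤-trans (≡⇒≤ (·-⋁ʳ a f)) (⋁≤ h)

    ⋁·⋁-least : ∀ {I J : Set} {f : I → Carrier} {g : J → Carrier} {c} →
      (∀ i j → (f i · g j) ≤ c) → (⋁ f · ⋁ g) ≤ c
    ⋁·⋁-least h = ⋁·-least λ i → ·⋁-least (h i)

module MonoidConvolution (Q : InterchangeQuantale) where
  open LatticeFacts Q

  module Along {S : Set} {_≼_ D : S → S → Set} {_⊗_ : S → S → S} {E : S → Set}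
    (pm : IsPreorderedPartialMonoid _≼_ D _⊗_ E)
    (_·_ : Carrier → Carrier → Carrier)
    (·-assoc : ∀ a b c → ((a · b) · c) ≡ (a · (b · c)))
    (·-⋁ˡ : ∀ {I : Set} (f : I → Carrier) b → (⋁ f · b) ≡ ⋁ (λ i → f i · b))
    (·-⋁ʳ : ∀ {I : Set} a (f : I → Carrier) → (a · ⋁ f) ≡ ⋁ (λ i → a · f i))
    (·-identityˡ : ∀ a → (𝟙 · a) ≡ a)
    (·-identityʳ : ∀ a → (a · 𝟙) ≡ a) where

    open SupPreserving _·_ ·-⋁ˡ ·-⋁ʳ
    open IsPreorderedPartialMonoid pm
    module PR = IsPreorder ≼-isPreorder

    ≼-refl : ∀ {x} → x ≼ x
    ≼-refl = PR.reflexive refl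

    _⋆_ : (S → Carrier) → (S → Carrier) → S → Carrier
    (f ⋆ g) x = ⋁ {I = Σ[ y ∈ S ] Σ[ z ∈ S ] (D y z × x ≼ (y ⊗ z))}
                  (λ p → f (proj₁ p) · g (proj₁ (proj₂ p)))

    unit : S → Carrier
    unit x = ⋁ {I = E x} (λ _ → 𝟙)

    Antitone : (S → Carrier) → Set
    Antitone f = ∀ x y → x ≼ y → f y ≤ f x

    term≤⋆ : ∀ f g {x y z} → D y z → x ≼ (y ⊗ z) → (f y · g z) ≤ (f ⋆ g) x
    term≤⋆ f g Dyz x≼yz = ⋁-upper _ (_ , _ , Dyz , x≼yz)

    unit-absorbsˡ : ∀ {y z} → E y → D y z → y ⊗ z ≡ z
    unit-absorbsˡ {y} {z} Ey Dyz =
      let (e′ , Ee′ , De′z , e′z≡z) = left-unit z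
          Dye′ = proj₁ (D-assoc← y e′ z (De′z , subst (D y) (sym e′z≡z) Dyz))
      in trans (cong (_⊗ z) (unit-unique y e′ Ey Ee′ Dye′)) e′z≡z

    unit-absorbsʳ : ∀ {y z} → E z → D y z → y ⊗ z ≡ y
    unit-absorbsʳ {y} {z} Ez Dyz =
      let (e′ , Ee′ , Dye′ , ye′≡y) = right-unit y
          De′z = proj₁ (D-assoc→ y e′ z (Dye′ , subst (λ t → D t z) (sym ye′≡y) Dyz))
      in trans (cong (y ⊗_) (sym (unit-unique e′ z Ee′ Ez De′z))) ye′≡y

    -- Since f ⋆ g sums over all z ≽ x, it is antitone.
    ⋆-antitone : ∀ f g → Antitone (f ⋆ g)
    ⋆-antitone f g x x′ x≼x′ = ⋁≤ λ { (y , z , Dyz , x′≼yz) →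
      term≤⋆ f g Dyz (PR.trans x≼x′ x′≼yz) }

    unit-antitone : (∀ {x y} → x ≼ y → E y → E x) → Antitone unit
    unit-antitone E-down x y x≼y = ⋁≤ λ Ey → ⋁-upper _ (E-down x≼y Ey)

    ⋆-assoc : ∀ f g h x → ((f ⋆ g) ⋆ h) x ≡ (f ⋆ (g ⋆ h)) x
    ⋆-assoc f g h x = ≤-antisym
      (⋁≤ λ { (u , w , Duw , x≼uw) → ⋁·-least λ { (y , z , Dyz , u≼yz) →
        regroupʳ Duw x≼uw Dyz u≼yz } })
      (⋁≤ λ { (y , v , Dyv , x≼yv) → ·⋁-least λ { (z , w , Dzw , v≼zw) →
        regroupˡ Dyv x≼yv Dzw v≼zw } })
      where
      regroupʳ : ∀ {u w y z} → D u w → x ≼ (u ⊗ w) → D y z → u ≼ (y ⊗ z) →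
        ((f y · g z) · h w) ≤ (f ⋆ (g ⋆ h)) x
      regroupʳ {u} {w} {y} {z} Duw x≼uw Dyz u≼yz =
        let (D[yz]w , uw≼[yz]w) = mono-left u (y ⊗ z) w u≼yz Duw
            (Dzw , Dy[zw]) = D-assoc→ y z w (Dyz , D[yz]w)
            x≼y[zw] = PR.trans x≼uw
              (PR.trans uw≼[yz]w (PR.reflexive (sym (assoc y z w Dyz D[yz]w))))
        in begin
          (f y · g z) · h w      ≡⟨ ·-assoc _ _ _ ⟩
          f y · (g z · h w)      ≤⟨ monoʳ (term≤⋆ g h Dzw ≼-refl) ⟩
          f y · (g ⋆ h) (z ⊗ w)  ≤⟨ term≤⋆ f (g ⋆ h) Dy[zw] x≼y[zw] ⟩
          (f ⋆ (g ⋆ h)) x        ∎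

      regroupˡ : ∀ {y v z w} → D y v → x ≼ (y ⊗ v) → D z w → v ≼ (z ⊗ w) →
        (f y · (g z · h w)) ≤ ((f ⋆ g) ⋆ h) x
      regroupˡ {y} {v} {z} {w} Dyv x≼yv Dzw v≼zw =
        let (Dy[zw] , yv≼y[zw]) = mono-right v (z ⊗ w) y v≼zw Dyv
            (Dyz , D[yz]w) = D-assoc← y z w (Dzw , Dy[zw])
            x≼[yz]w = PR.trans x≼yv
              (PR.trans yv≼y[zw] (PR.reflexive (assoc y z w Dyz D[yz]w)))
        in begin
          f y · (g z · h w)      ≡⟨ ·-assoc _ _ _ ⟨
          (f y · g z) · h w      ≤⟨ monoˡ (term≤⋆ f g Dyz ≼-refl) ⟩
          (f ⋆ g) (y ⊗ z) · h w  ≤⟨ term≤⋆ (f ⋆ g) h D[yz]w x≼[yz]w ⟩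
          ((f ⋆ g) ⋆ h) x        ∎

    ⋆-⋁ˡ : ∀ {I : Set} (F : I → S → Carrier) g x →
      ((λ s → ⋁ (λ i → F i s)) ⋆ g) x ≡ ⋁ (λ i → (F i ⋆ g) x)
    ⋆-⋁ˡ F g x = trans (⋁-cong λ p → ·-⋁ˡ (λ i → F i (proj₁ p)) (g (proj₁ (proj₂ p))))
                       (⋁-comm _)

    ⋆-⋁ʳ : ∀ {I : Set} f (G : I → S → Carrier) x →
      (f ⋆ (λ s → ⋁ (λ i → G i s))) x ≡ ⋁ (λ i → (f ⋆ G i) x)
    ⋆-⋁ʳ f G x = trans (⋁-cong λ p → ·-⋁ʳ (f (proj₁ p)) (λ i → G i (proj₁ (proj₂ p))))
                       (⋁-comm _)

    ⋆-identityˡ : ∀ f → Antitone f → ∀ x → (unit ⋆ f) x ≡ f x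
    ⋆-identityˡ f f-anti x = ≤-antisym
      (⋁≤ λ { (y , z , Dyz , x≼yz) → ⋁·-least λ Ey → begin
        𝟙 · f z  ≡⟨ ·-identityˡ (f z) ⟩
        f z      ≤⟨ f-anti x z (PR.trans x≼yz (PR.reflexive (unit-absorbsˡ Ey Dyz))) ⟩
        f x      ∎ })
      (let (e′ , Ee′ , De′x , e′x≡x) = left-unit x in begin
        f x             ≡⟨ ·-identityˡ (f x) ⟨
        𝟙 · f x         ≤⟨ monoˡ (⋁-upper _ Ee′) ⟩
        unit e′ · f x   ≤⟨ term≤⋆ unit f De′x (PR.reflexive (sym e′x≡x)) ⟩
        (unit ⋆ f) x    ∎)

    ⋆-identityʳ : ∀ f → Antitone f → ∀ x → (f ⋆ unit) x ≡ f x
    ⋆-identityʳ f f-anti x = ≤-antisym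
      (⋁≤ λ { (y , z , Dyz , x≼yz) → ·⋁-least λ Ez → begin
        f y · 𝟙  ≡⟨ ·-identityʳ (f y) ⟩
        f y      ≤⟨ f-anti x y (PR.trans x≼yz (PR.reflexive (unit-absorbsʳ Ez Dyz))) ⟩
        f x      ∎ })
      (let (e′ , Ee′ , Dxe′ , xe′≡x) = right-unit x in begin
        f x             ≡⟨ ·-identityʳ (f x) ⟨
        f x · 𝟙         ≤⟨ monoʳ (⋁-upper _ Ee′) ⟩
        f x · unit e′   ≤⟨ term≤⋆ f unit Dxe′ (PR.reflexive (sym xe′≡x)) ⟩
        (f ⋆ unit) x    ∎)

module AntitoneAlgebra (M : SingleUnitPIM) (Q : InterchangeQuantale) where
  open SingleUnitPIM M
  open IsPartialInterchangeMonoid isPIM renaming (interchange to ⊗-interchange)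
  module PM₁ = IsPreorderedPartialMonoid isPM₁
  module PR = IsPreorder PM₁.≼-isPreorder
  open LatticeFacts Q
  open Convolution M Q
  open MonoidConvolution Q
  open SupPreserving _◇_ ◇-⋁ˡ ◇-⋁ʳ using () renaming (mono to ◇-mono)

  module Seq = Along (discrete isPM₁) _•_ •-assoc •-⋁ˡ •-⋁ʳ •-identityˡ •-identityʳ
  module Par = Along isPM₂ _◇_ ◇-assoc ◇-⋁ˡ ◇-⋁ʳ ◇-identityˡ ◇-identityʳ

  ≡-antitone : ∀ f → Seq.Antitone f
  ≡-antitone f x .x refl = ≤-refl

  idf-antitone : Positive M → Antitone idf
  idf-antitone pos = Par.unit-antitone λ {x} x≼y y≡e → pos x (subst (x ≼_) y≡e x≼y)

  ⋁-closed : SupClosed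
  ⋁-closed F F-anti x y x≼y = ⋁≤ λ i →
    ≤-trans (F-anti i x y x≼y) (⋁-upper (λ i → F i x) i)

  -- Serial decomposability: a ∗-decomposition of some y ≽ x induces one of x
  -- into smaller pieces, whose terms dominate by antitonicity.
  ∗-closed : SeriallyDecomposable M → ∗Closed
  ∗-closed sd f g f-anti g-anti x y x≼y = ⋁≤ λ { (y₁ , y₂ , D₁y₁y₂ , y≡y₁y₂) →
    let (x₁ , x₂ , D₁x₁x₂ , x≡x₁x₂ , x₁≼y₁ , x₂≼y₂) =
          sd x y₁ y₂ D₁y₁y₂ (subst (x ≼_) y≡y₁y₂ x≼y)
    in begin
      f y₁ • g y₂   ≤⟨ •-mono (f-anti x₁ y₁ x₁≼y₁) (g-anti x₂ y₂ x₂≼y₂) ⟩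
      f x₁ • g x₂   ≤⟨ Seq.term≤⋆ f g D₁x₁x₂ x≡x₁x₂ ⟩
      (f ∗ g) x     ∎ }
    where open SupPreserving _•_ •-⋁ˡ •-⋁ʳ using () renaming (mono to •-mono)

  ⊛-closed : ⊛Closed
  ⊛-closed f g _ _ = Par.⋆-antitone f g

  -- The interchange law of the convolutions: each term of the left side is
  -- bounded, via the interchange law of Q, by a term of the right side whose
  -- index is produced by the interchange law of M.
  ∗⊛-interchange : ∀ f g h k x → ((f ⊛ g) ∗ (h ⊛ k)) x ≤ ((f ∗ h) ⊛ (g ∗ k)) x
  ∗⊛-interchange f g h k x = ⋁≤ λ { (u , v , D₁uv , x≡uv) →
    ⋁·⋁-least λ { (w , w′ , D₂ww′ , u≼ww′) (y , z , D₂yz , v≼yz) →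
      interchange-term x≡uv D₁uv D₂ww′ u≼ww′ D₂yz v≼yz } }
    where
    open SupPreserving _•_ •-⋁ˡ •-⋁ʳ using (⋁·⋁-least)

    interchange-term : ∀ {u v w w′ y z} → x ≡ u ⊗₁ v → D₁ u v →
      D₂ w w′ → u ≼ (w ⊗₂ w′) → D₂ y z → v ≼ (y ⊗₂ z) →
      ((f w ◇ g w′) • (h y ◇ k z)) ≤ ((f ∗ h) ⊛ (g ∗ k)) x
    interchange-term {u} {v} {w} {w′} {y} {z} x≡uv D₁uv D₂ww′ u≼ww′ D₂yz v≼yz =
      let (D₁[ww′]v , uv≼[ww′]v) = PM₁.mono-left u (w ⊗₂ w′) v u≼ww′ D₁uv
          (D₁[ww′][yz] , [ww′]v≼[ww′][yz]) =
            PM₁.mono-right v (y ⊗₂ z) (w ⊗₂ w′) v≼yz D₁[ww′]v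
          (D₁wy , D₂[wy][w′z] , D₁w′z , [ww′][yz]≼[wy][w′z]) =
            ⊗-interchange w w′ y z D₂ww′ D₁[ww′][yz] D₂yz
          x≼[wy][w′z] = PR.trans (PR.reflexive x≡uv) (PR.trans uv≼[ww′]v
                          (PR.trans [ww′]v≼[ww′][yz] [ww′][yz]≼[wy][w′z]))
      in begin
        (f w ◇ g w′) • (h y ◇ k z)                 ≤⟨ interchange _ _ _ _ ⟩
        (f w • h y) ◇ (g w′ • k z)                 ≤⟨ ◇-mono (Seq.term≤⋆ f h D₁wy refl)
                                                             (Seq.term≤⋆ g k D₁w′z refl) ⟩
        (f ∗ h) (w ⊗₁ y) ◇ (g ∗ k) (w′ ⊗₁ z)       ≤⟨ Par.term≤⋆ (f ∗ h) (g ∗ k)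
                                                             D₂[wy][w′z] x≼[wy][w′z] ⟩
        ((f ∗ h) ⊛ (g ∗ k)) x                      ∎

  pointwise-isPartialOrder : IsPartialOrder _≈ᴬ_ _≤ᴬ_
  pointwise-isPartialOrder = record
    { isPreorder = record
      { isEquivalence = record
        { refl  = λ _ → refl
        ; sym   = λ F≈G x → sym (F≈G x)
        ; trans = λ F≈G G≈H x → trans (F≈G x) (G≈H x) }
      ; reflexive = λ F≈G x → ≡⇒≤ (F≈G x)
      ; trans     = λ F≤G G≤H x → ≤-trans (F≤G x) (G≤H x) }
    ; antisym = λ F≤G G≤F x → ≤-antisym (F≤G x) (G≤F x) }

  A-isInterchangeQuantale : (idA : Antitone idf) (supA : SupClosed)
    (∗A : ∗Closed) (⊛A : ⊛Closed) →
    IsInterchangeQuantale A _≈ᴬ_ _≤ᴬ_ (⋁ᴬ supA) (∗ᴬ ∗A) (⊛ᴬ ⊛A) (idf , idA)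
  A-isInterchangeQuantale idA supA ∗A ⊛A = record
    { isPartialOrder = pointwise-isPartialOrder
    ; ⋁-upper     = λ F i x → ⋁-upper (λ j → proj₁ (F j) x) i
    ; ⋁-least     = λ F c F≤c x → ⋁-least (λ j → proj₁ (F j) x) (proj₁ c x) (λ i → F≤c i x)
    ; •-assoc     = λ (f , _) (g , _) (h , _) → Seq.⋆-assoc f g h
    ; ◇-assoc     = λ (f , _) (g , _) (h , _) → Par.⋆-assoc f g h
    ; •-⋁ˡ        = λ F (g , _) → Seq.⋆-⋁ˡ (λ i → proj₁ (F i)) g
    ; •-⋁ʳ        = λ (f , _) G → Seq.⋆-⋁ʳ f (λ i → proj₁ (G i))
    ; ◇-⋁ˡ        = λ F (g , _) → Par.⋆-⋁ˡ (λ i → proj₁ (F i)) g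
    ; ◇-⋁ʳ        = λ (f , _) G → Par.⋆-⋁ʳ f (λ i → proj₁ (G i))
    ; •-identityˡ = λ (f , _) → Seq.⋆-identityˡ f (≡-antitone f)
    ; •-identityʳ = λ (f , _) → Seq.⋆-identityʳ f (≡-antitone f)
    ; ◇-identityˡ = λ (f , f-anti) → Par.⋆-identityˡ f f-anti
    ; ◇-identityʳ = λ (f , f-anti) → Par.⋆-identityʳ f f-anti
    ; interchange = λ (f , _) (g , _) (h , _) (k , _) → ∗⊛-interchange f g h k
    }

proposition9p12 : (M : SingleUnitPIM) (Q : InterchangeQuantale) →
    Positive M → SeriallyDecomposable M →
    let open Convolution M Q in
    Σ[ idA ∈ Antitone idf ]
    Σ[ supA ∈ SupClosed ]
    Σ[ ∗A ∈ ∗Closed ]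
    Σ[ ⊛A ∈ ⊛Closed ]
    IsInterchangeQuantale A _≈ᴬ_ _≤ᴬ_ (⋁ᴬ supA) (∗ᴬ ∗A) (⊛ᴬ ⊛A) (idf , idA)
proposition9p12 M Q pos sd =
  idf-antitone pos , ⋁-closed , ∗-closed sd , ⊛-closed ,
  A-isInterchangeQuantale (idf-antitone pos) ⋁-closed (∗-closed sd) ⊛-closed
  where open AntitoneAlgebra M Q
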